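{- For all $n \ge 1$: (1) there is exactly one line of the form $\{x, x+e_1, x+2e_1\}$ ($x \in \mathbb{Z}_3^n$) which contains two points of $D_n$; (2) for every $k \in \{2,\dots,n\}$, there are exactly $3^{k-2}$ lines of the form $\{x, x+e_k, x+2e_k\}$ ($x \in \mathbb{Z}_3^n$) which contain two points of $D_n$.
   Context: $e_1,\dots,e_n$ is the standard basis of $\mathbb{Z}_3^n$; lines are counted as sets. $A_n = \{x \in \mathbb{Z}_3^n : \sum_i x_i \equiv 0 \pmod 3\}$. For $S \subseteq \mathbb{Z}_3^{n}$ and $c \in \mathbb{Z}_3$, $(S,c) = \{(x_1,\dots,x_{n},c) : (x_1,\dots,x_n) \in S\} \subseteq \mathbb{Z}_3^{n+1}$. The sets $D_n \subseteq \mathbb{Z}_3^n$ are defined by $D_1 = \{1,2\}$ and $D_{n+1} = (D_n,0) \cup (A_n,1) \cup (A_n,2)$. -}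

module Defs where

open import Data.Nat using (ℕ; zero; suc)
open import Data.Fin using (Fin; zero; suc)
open import Data.Vec using (Vec; []; _∷_; init; last; foldr; zipWith; replicate; updateAt)
open import Data.List using (List; length)
open import Data.List.Relation.Unary.All using (All)
open import Data.List.Relation.Unary.Any using (Any)
open import Data.List.Relation.Unary.AllPairs using (AllPairs)
open import Data.Product using (Σ; _×_; ∃; ∃-syntax)
open import Data.Sum using (_⊎_)
open import Data.Empty using (⊥)
open import Relation.Nullary using (¬_)
open import Relation.Binary.PropositionalEquality using (_≡_; _≢_)
open import Function.Bundles using (_⇔_)

ℤ₃ : Set
ℤ₃ = Fin 3

_⊕_ : ℤ₃ → ℤ₃ → ℤ₃
zero ⊕ b = b
suc zero ⊕ zero = suc zero
suc zero ⊕ suc zero = suc (suc zero)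
suc zero ⊕ suc (suc zero) = zero
suc (suc zero) ⊕ zero = suc (suc zero)
suc (suc zero) ⊕ suc zero = zero
suc (suc zero) ⊕ suc (suc zero) = suc zero

_⊙_ : ℤ₃ → ℤ₃ → ℤ₃
zero ⊙ c = zero
suc zero ⊙ c = c
suc (suc zero) ⊙ c = c ⊕ c

-- points of ℤ₃ⁿ: vectors; coordinate i (0-based) is paper coordinate i+1
Pt : ℕ → Set
Pt n = Vec ℤ₃ n

_+ᵥ_ : ∀ {n} → Pt n → Pt n → Pt n
_+ᵥ_ = zipWith _⊕_

_·ᵥ_ : ∀ {n} → ℤ₃ → Pt n → Pt n
t ·ᵥ x = Data.Vec.map (t ⊙_) x

-- standard basis vector e_{k+1} (0-based index k)
e : ∀ {n} → Fin n → Pt n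
e k = updateAt (replicate _ zero) k (λ _ → suc zero)

InA : ∀ {n} → Pt n → Set
InA x = foldr _ _⊕_ zero x ≡ zero

-- D_n (n ≥ 1): D_1 = {1,2}, D_{n+1} = (D_n,0) ∪ (A_n,1) ∪ (A_n,2),
-- the new coordinate being appended as the LAST coordinate.
InD : (n : ℕ) → Pt n → Set
InD zero x = ⊥
InD (suc zero) x = last x ≢ zero
InD (suc (suc n)) x =
  (InD (suc n) (init x) × last x ≡ zero) ⊎ (InA (init x) × last x ≢ zero)

_∈Line[_,_] : ∀ {n} → Pt n → Fin n → Pt n → Set
y ∈Line[ k , x ] = ∃[ t ] y ≡ x +ᵥ (t ·ᵥ e k)

SameLine : ∀ {n} → Fin n → Pt n → Pt n → Set
SameLine {n} k x x′ = (y : Pt n) → (y ∈Line[ k , x ] ⇔ y ∈Line[ k , x′ ])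

ContainsTwo : (n : ℕ) → Fin n → Pt n → Set
ContainsTwo n k x = ∃[ y ] ∃[ z ] (y ≢ z × y ∈Line[ k , x ] × z ∈Line[ k , x ]
                                     × InD n y × InD n z)

ExactlyLines : (n : ℕ) → Fin n → ℕ → Set
ExactlyLines n k m =
  Σ (List (Pt n)) λ xs →
    length xs ≡ m
    × All (ContainsTwo n k) xs
    × AllPairs (λ x x′ → ¬ SameLine k x x′) xs
    × ((x : Pt n) → ContainsTwo n k x → Any (SameLine k x) xs)

{-# OPTIONS --safe #-}
-- Write points of ℤ₃^{n+1} as (p, c) with c the last coordinate. A line in an old direction e_k
-- (k ≤ n) keeps c fixed. For c = 0 its points in D_{n+1} are (D_n, 0); for c ≠ 0 they are the
-- points with p ∈ A_n, and the line meets A_n at most once since the coordinate sum moves with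
-- the line parameter. So the lines in direction e_k with two points of D_{n+1} are exactly the
-- lines (ℓ, 0) with ℓ such a line for D_n, and their number does not change. The line in the new
-- direction e_{n+1} through (p, c) is {p} × ℤ₃; it contains two points of D_{n+1} iff p ∈ A_n,
-- and A_n ≅ ℤ₃^{n-1} (the first coordinate is determined by the others), giving 3^{n-1} lines.
-- Induction on n starts from the single line ℤ₃ ⊇ D_1 = {1, 2}.
module Submission where

open import Defs
open import Data.Nat using (ℕ; suc; _^_; _∸_; _≤_)
open import Data.Fin using (Fin; zero; toℕ)
open import Data.Product using (_×_)

open import Data.Nat using (_+_; _*_)
open import Data.Fin using (suc; inject₁; fromℕ)
open import Data.Fin.Properties using (all?; _≟_; toℕ-inject₁; toℕ-fromℕ)
open import Data.Fin.Relation.Unary.Top using (view; ‵fromℕ; ‵inject₁)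
open import Data.Vec using (Vec; []; _∷_; _∷ʳ_; foldr; replicate; initLast; tail; updateAt)
open import Data.Vec.Properties
  using (∷-injective; ∷ʳ-injectiveˡ; ∷ʳ-injectiveʳ; init-∷ʳ; last-∷ʳ;
         updateAt-id-local; updateAt-updateAt-local)
open import Data.List using (List; []; _∷_; [_]; _++_; map; length; cartesianProductWith; allFin)
open import Data.List.Properties using (length-++; length-map)
open import Data.List.Membership.Propositional using (_∈_)
open import Data.List.Membership.Propositional.Properties using (∈-allFin; ∈-cartesianProductWith⁺)
open import Data.List.Relation.Unary.All as All using (All; []; _∷_)
import Data.List.Relation.Unary.All.Properties as All
open import Data.List.Relation.Unary.Any as Any using (Any; here)
import Data.List.Relation.Unary.Any.Properties as Any
open import Data.List.Relation.Unary.AllPairs as AllPairs using (AllPairs; []; _∷_)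
import Data.List.Relation.Unary.AllPairs.Properties as AllPairs
open import Data.List.Relation.Unary.Unique.Propositional using (Unique)
import Data.List.Relation.Unary.Unique.Propositional.Properties as Unique
open import Data.Product using (∃; ∃₂; _,_; proj₁; proj₂)
open import Data.Sum using (_⊎_; inj₁; inj₂)
open import Function using (_∘_; mk⇔; Equivalence)
open import Relation.Binary.PropositionalEquality
  using (_≡_; _≢_; _≗_; refl; sym; trans; cong; cong₂; subst; subst₂; module ≡-Reasoning)
open import Relation.Nullary using (¬_; contradiction)
open import Relation.Nullary.Decidable using (from-yes; _→-dec_)

pattern 𝟘 = zero
pattern 𝟙 = suc zero
pattern 𝟚 = suc (suc zero)

neg : ℤ₃ → ℤ₃
neg 𝟘 = 𝟘
neg 𝟙 = 𝟚
neg 𝟚 = 𝟙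

Σ₃ : ∀ {n} → Pt n → ℤ₃
Σ₃ = foldr _ _⊕_ 𝟘

⊕-identityʳ : ∀ a → a ⊕ 𝟘 ≡ a
⊕-identityʳ = from-yes (all? λ a → a ⊕ 𝟘 ≟ a)

⊕-comm : ∀ a b → a ⊕ b ≡ b ⊕ a
⊕-comm = from-yes (all? λ a → all? λ b → a ⊕ b ≟ b ⊕ a)

⊕-assoc : ∀ a b c → (a ⊕ b) ⊕ c ≡ a ⊕ (b ⊕ c)
⊕-assoc = from-yes (all? λ a → all? λ b → all? λ c → (a ⊕ b) ⊕ c ≟ a ⊕ (b ⊕ c))

⊕-inverseˡ : ∀ a → neg a ⊕ a ≡ 𝟘
⊕-inverseˡ = from-yes (all? λ a → neg a ⊕ a ≟ 𝟘)

⊕-inverseʳ : ∀ a → a ⊕ neg a ≡ 𝟘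
⊕-inverseʳ = from-yes (all? λ a → a ⊕ neg a ≟ 𝟘)

⊕-cancelˡ : ∀ a b c → a ⊕ b ≡ a ⊕ c → b ≡ c
⊕-cancelˡ = from-yes (all? λ a → all? λ b → all? λ c → (a ⊕ b ≟ a ⊕ c) →-dec (b ≟ c))

inverseˡ-unique : ∀ a b → a ⊕ b ≡ 𝟘 → a ≡ neg b
inverseˡ-unique = from-yes (all? λ a → all? λ b → (a ⊕ b ≟ 𝟘) →-dec (a ≟ neg b))

⊙-zeroʳ : ∀ t → t ⊙ 𝟘 ≡ 𝟘
⊙-zeroʳ = from-yes (all? λ t → t ⊙ 𝟘 ≟ 𝟘)

⊙-identityʳ : ∀ t → t ⊙ 𝟙 ≡ t
⊙-identityʳ = from-yes (all? λ t → t ⊙ 𝟙 ≟ t)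

updateAt-inject₁-∷ʳ : ∀ {a} {A : Set a} {n} (xs : Vec A n) k (f : A → A) c →
                      updateAt (xs ∷ʳ c) (inject₁ k) f ≡ updateAt xs k f ∷ʳ c
updateAt-inject₁-∷ʳ (x ∷ xs) zero    f c = refl
updateAt-inject₁-∷ʳ (x ∷ xs) (suc k) f c = cong (x ∷_) (updateAt-inject₁-∷ʳ xs k f c)

updateAt-fromℕ-∷ʳ : ∀ {a} {A : Set a} {n} (xs : Vec A n) (f : A → A) c →
                    updateAt (xs ∷ʳ c) (fromℕ n) f ≡ xs ∷ʳ f c
updateAt-fromℕ-∷ʳ []       f c = refl
updateAt-fromℕ-∷ʳ (x ∷ xs) f c = cong (x ∷_) (updateAt-fromℕ-∷ʳ xs f c)

line : ∀ {n} → Fin n → Pt n → ℤ₃ → Pt n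
line k x t = updateAt x k (_⊕ t)

+ᵥ-·ᵥ-zero : ∀ {n} (x : Pt n) t → x +ᵥ (t ·ᵥ replicate n 𝟘) ≡ x
+ᵥ-·ᵥ-zero []      t = refl
+ᵥ-·ᵥ-zero (a ∷ x) t =
  cong₂ _∷_ (trans (cong (a ⊕_) (⊙-zeroʳ t)) (⊕-identityʳ a)) (+ᵥ-·ᵥ-zero x t)

+ᵥ-·ᵥe : ∀ {n} (x : Pt n) k t → x +ᵥ (t ·ᵥ e k) ≡ line k x t
+ᵥ-·ᵥe (a ∷ x) zero    t = cong₂ _∷_ (cong (a ⊕_) (⊙-identityʳ t)) (+ᵥ-·ᵥ-zero x t)
+ᵥ-·ᵥe (a ∷ x) (suc k) t =
  cong₂ _∷_ (trans (cong (a ⊕_) (⊙-zeroʳ t)) (⊕-identityʳ a)) (+ᵥ-·ᵥe x k t)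

line-zero : ∀ {n} (k : Fin n) x → line k x 𝟘 ≡ x
line-zero k x = updateAt-id-local k x (⊕-identityʳ _)

line-line : ∀ {n} (k : Fin n) x s t → line k (line k x s) t ≡ line k x (s ⊕ t)
line-line k x s t = updateAt-updateAt-local k x (⊕-assoc _ s t)

line-inject₁ : ∀ {n} (k : Fin n) p c t → line (inject₁ k) (p ∷ʳ c) t ≡ line k p t ∷ʳ c
line-inject₁ k p c t = updateAt-inject₁-∷ʳ p k (_⊕ t) c

line-fromℕ : ∀ {n} (p : Pt n) c t → line (fromℕ n) (p ∷ʳ c) t ≡ p ∷ʳ (c ⊕ t)
line-fromℕ p c t = updateAt-fromℕ-∷ʳ p (_⊕ t) c

Σ₃-line : ∀ {n} (x : Pt n) k t → Σ₃ (line k x t) ≡ Σ₃ x ⊕ t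
Σ₃-line (a ∷ x) zero t = begin
  (a ⊕ t) ⊕ Σ₃ x  ≡⟨ ⊕-assoc a t (Σ₃ x) ⟩
  a ⊕ (t ⊕ Σ₃ x)  ≡⟨ cong (a ⊕_) (⊕-comm t (Σ₃ x)) ⟩
  a ⊕ (Σ₃ x ⊕ t)  ≡⟨ ⊕-assoc a (Σ₃ x) t ⟨
  (a ⊕ Σ₃ x) ⊕ t  ∎
  where open ≡-Reasoning
Σ₃-line (a ∷ x) (suc k) t = trans (cong (a ⊕_) (Σ₃-line x k t)) (sym (⊕-assoc a (Σ₃ x) t))

line-InA-unique : ∀ {n} (k : Fin n) x {s t} → InA (line k x s) → InA (line k x t) → s ≡ t
line-InA-unique k x {s} {t} as at = ⊕-cancelˡ (Σ₃ x) s t (begin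
  Σ₃ x ⊕ s          ≡⟨ Σ₃-line x k s ⟨
  Σ₃ (line k x s)   ≡⟨ trans as (sym at) ⟩
  Σ₃ (line k x t)   ≡⟨ Σ₃-line x k t ⟩
  Σ₃ x ⊕ t          ∎)
  where open ≡-Reasoning

module _ {n} {k : Fin n} where

  ∈Line-line : ∀ x t → line k x t ∈Line[ k , x ]
  ∈Line-line x t = t , sym (+ᵥ-·ᵥe x k t)

  ∈Line⇒line : ∀ {x y} → y ∈Line[ k , x ] → ∃ λ t → y ≡ line k x t
  ∈Line⇒line {x} (t , refl) = t , +ᵥ-·ᵥe x k t

  ∈Line-refl : ∀ {x} → x ∈Line[ k , x ]
  ∈Line-refl {x} = subst (_∈Line[ k , x ]) (line-zero k x) (∈Line-line x 𝟘)

  ∈Line-trans : ∀ {x y z} → y ∈Line[ k , x ] → z ∈Line[ k , y ] → z ∈Line[ k , x ]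
  ∈Line-trans {x} y∈ z∈ with ∈Line⇒line y∈ | ∈Line⇒line z∈
  ... | s , refl | t , refl =
    subst (_∈Line[ k , x ]) (sym (line-line k x s t)) (∈Line-line x (s ⊕ t))

  ∈Line-sym : ∀ {x y} → y ∈Line[ k , x ] → x ∈Line[ k , y ]
  ∈Line-sym {x} y∈ with ∈Line⇒line y∈
  ... | s , refl = subst (_∈Line[ k , line k x s ]) back (∈Line-line (line k x s) (neg s))
    where
    back : line k (line k x s) (neg s) ≡ x
    back = begin
      line k (line k x s) (neg s)  ≡⟨ line-line k x s (neg s) ⟩
      line k x (s ⊕ neg s)         ≡⟨ cong (line k x) (⊕-inverseʳ s) ⟩
      line k x 𝟘                   ≡⟨ line-zero k x ⟩
      x                            ∎
      where open ≡-Reasoning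

  ∈Line⇒SameLine : ∀ {x x′} → x′ ∈Line[ k , x ] → SameLine k x x′
  ∈Line⇒SameLine x′∈ y = mk⇔ (∈Line-trans (∈Line-sym x′∈)) (∈Line-trans x′∈)

  SameLine⇒∈Line : ∀ {x x′} → SameLine k x x′ → x′ ∈Line[ k , x ]
  SameLine⇒∈Line {x′ = x′} same = Equivalence.from (same x′) ∈Line-refl

SameLine-inject₁ : ∀ {n} (k : Fin n) {p p′ : Pt n} c →
                   SameLine k p p′ → SameLine (inject₁ k) (p ∷ʳ c) (p′ ∷ʳ c)
SameLine-inject₁ k {p} c same with ∈Line⇒line (SameLine⇒∈Line {k = k} same)
... | t , refl =
  ∈Line⇒SameLine (subst (_∈Line[ inject₁ k , p ∷ʳ c ]) (line-inject₁ k p c t) (∈Line-line (p ∷ʳ c) t))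

SameLine-inject₁⁻ : ∀ {n} (k : Fin n) (p p′ : Pt n) {c c′} →
                    SameLine (inject₁ k) (p ∷ʳ c) (p′ ∷ʳ c′) → SameLine k p p′
SameLine-inject₁⁻ k p p′ {c} same with ∈Line⇒line (SameLine⇒∈Line {k = inject₁ k} same)
... | t , eq = ∈Line⇒SameLine (subst (_∈Line[ k , p ]) p+te≡p′ (∈Line-line p t))
  where
  p+te≡p′ : line k p t ≡ p′
  p+te≡p′ = sym (∷ʳ-injectiveˡ p′ (line k p t) (trans eq (line-inject₁ k p c t)))

SameLine-fromℕ : ∀ {n} (p : Pt n) c c′ → SameLine (fromℕ n) (p ∷ʳ c) (p ∷ʳ c′)
SameLine-fromℕ p c c′ =
  ∈Line⇒SameLine (subst (_∈Line[ fromℕ _ , p ∷ʳ c ]) p∷c+t≡p∷c′ (∈Line-line (p ∷ʳ c) (neg c ⊕ c′)))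
  where
  p∷c+t≡p∷c′ : line (fromℕ _) (p ∷ʳ c) (neg c ⊕ c′) ≡ p ∷ʳ c′
  p∷c+t≡p∷c′ = begin
    line (fromℕ _) (p ∷ʳ c) (neg c ⊕ c′)  ≡⟨ line-fromℕ p c (neg c ⊕ c′) ⟩
    p ∷ʳ (c ⊕ (neg c ⊕ c′))               ≡⟨ cong (p ∷ʳ_) (⊕-assoc c (neg c) c′) ⟨
    p ∷ʳ ((c ⊕ neg c) ⊕ c′)               ≡⟨ cong (λ d → p ∷ʳ (d ⊕ c′)) (⊕-inverseʳ c) ⟩
    p ∷ʳ c′                               ∎
    where open ≡-Reasoning

SameLine-fromℕ⁻ : ∀ {n} (p p′ : Pt n) {c c′} → SameLine (fromℕ n) (p ∷ʳ c) (p′ ∷ʳ c′) → p′ ≡ p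
SameLine-fromℕ⁻ p p′ {c} same with ∈Line⇒line (SameLine⇒∈Line {k = fromℕ _} same)
... | t , eq = ∷ʳ-injectiveˡ p′ p (trans eq (line-fromℕ p c t))

TwoInD : (n : ℕ) → (ℤ₃ → Pt n) → Set
TwoInD n ℓ = ∃₂ λ s t → ℓ s ≢ ℓ t × InD n (ℓ s) × InD n (ℓ t)

TwoInD-≗ : ∀ {n} {ℓ ℓ′ : ℤ₃ → Pt n} → ℓ ≗ ℓ′ → TwoInD n ℓ → TwoInD n ℓ′
TwoInD-≗ {n} ℓ≗ℓ′ (s , t , ℓs≢ℓt , ds , dt) =
  s , t , (λ eq → ℓs≢ℓt (trans (ℓ≗ℓ′ s) (trans eq (sym (ℓ≗ℓ′ t)))))
    , subst (InD n) (ℓ≗ℓ′ s) ds , subst (InD n) (ℓ≗ℓ′ t) dt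

ContainsTwo⇒TwoInD : ∀ {n k x} → ContainsTwo n k x → TwoInD n (line k x)
ContainsTwo⇒TwoInD (y , z , y≢z , y∈ , z∈ , dy , dz) with ∈Line⇒line y∈ | ∈Line⇒line z∈
... | s , refl | t , refl = s , t , y≢z , dy , dz

TwoInD⇒ContainsTwo : ∀ {n k x} → TwoInD n (line k x) → ContainsTwo n k x
TwoInD⇒ContainsTwo {x = x} (s , t , s≢t , ds , dt) =
  _ , _ , s≢t , ∈Line-line x s , ∈Line-line x t , ds , dt

module _ {m} (p : Pt (suc m)) (c : ℤ₃) where

  InD-∷ʳ⁺ : (InD (suc m) p × c ≡ 𝟘) ⊎ (InA p × c ≢ 𝟘) → InD (suc (suc m)) (p ∷ʳ c)
  InD-∷ʳ⁺ = subst₂ (λ q d → (InD (suc m) q × d ≡ 𝟘) ⊎ (InA q × d ≢ 𝟘))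
                   (sym (init-∷ʳ c p)) (sym (last-∷ʳ c p))

  InD-∷ʳ⁻ : InD (suc (suc m)) (p ∷ʳ c) → (InD (suc m) p × c ≡ 𝟘) ⊎ (InA p × c ≢ 𝟘)
  InD-∷ʳ⁻ = subst₂ (λ q d → (InD (suc m) q × d ≡ 𝟘) ⊎ (InA q × d ≢ 𝟘))
                   (init-∷ʳ c p) (last-∷ʳ c p)

TwoInD-∷ʳ𝟘 : ∀ {m} {ℓ : ℤ₃ → Pt (suc m)} → TwoInD (suc m) ℓ → TwoInD (suc (suc m)) (λ t → ℓ t ∷ʳ 𝟘)
TwoInD-∷ʳ𝟘 {ℓ = ℓ} (s , t , ℓs≢ℓt , ds , dt) =
  s , t , ℓs≢ℓt ∘ ∷ʳ-injectiveˡ (ℓ s) (ℓ t)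
    , InD-∷ʳ⁺ (ℓ s) 𝟘 (inj₁ (ds , refl)) , InD-∷ʳ⁺ (ℓ t) 𝟘 (inj₁ (dt , refl))

-- Points of D_{m+2} off the hyperplane x_{m+2} = 0 lie over A_{m+1}, which ℓ meets at most once.
TwoInD-∷ʳ⁻ : ∀ {m} {ℓ : ℤ₃ → Pt (suc m)} {c} → (∀ {s t} → InA (ℓ s) → InA (ℓ t) → s ≡ t) →
             TwoInD (suc (suc m)) (λ t → ℓ t ∷ʳ c) → TwoInD (suc m) ℓ × c ≡ 𝟘
TwoInD-∷ʳ⁻ {ℓ = ℓ} {c} meetsA-once (s , t , x≢y , dx , dy)
  with InD-∷ʳ⁻ (ℓ s) c dx | InD-∷ʳ⁻ (ℓ t) c dy
... | inj₁ (ds , c≡𝟘) | inj₁ (dt , _)   = (s , t , x≢y ∘ cong (_∷ʳ c) , ds , dt) , c≡𝟘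
... | inj₁ (_ , c≡𝟘)  | inj₂ (_ , c≢𝟘)  = contradiction c≡𝟘 c≢𝟘
... | inj₂ (_ , c≢𝟘)  | inj₁ (_ , c≡𝟘)  = contradiction c≡𝟘 c≢𝟘
... | inj₂ (as , _)   | inj₂ (at , _)   = contradiction (cong (λ u → ℓ u ∷ʳ c) (meetsA-once as at)) x≢y

TwoInD-vertical : ∀ {m} {p : Pt (suc m)} → InA p → TwoInD (suc (suc m)) (p ∷ʳ_)
TwoInD-vertical {p = p} a =
  𝟙 , 𝟚 , 𝟙≢𝟚 ∘ ∷ʳ-injectiveʳ p p , InD-∷ʳ⁺ p 𝟙 (inj₂ (a , λ ())) , InD-∷ʳ⁺ p 𝟚 (inj₂ (a , λ ()))
  where
  𝟙≢𝟚 : 𝟙 ≢ 𝟚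
  𝟙≢𝟚 ()

TwoInD-vertical⁻ : ∀ {m} {p : Pt (suc m)} {ρ : ℤ₃ → ℤ₃} →
                   TwoInD (suc (suc m)) (λ t → p ∷ʳ ρ t) → InA p
TwoInD-vertical⁻ {p = p} {ρ} (s , t , x≢y , dx , dy)
  with InD-∷ʳ⁻ p (ρ s) dx | InD-∷ʳ⁻ p (ρ t) dy
... | inj₂ (a , _)    | _               = a
... | inj₁ _          | inj₂ (a , _)    = a
... | inj₁ (_ , ρs≡𝟘) | inj₁ (_ , ρt≡𝟘) = contradiction (cong (p ∷ʳ_) (trans ρs≡𝟘 (sym ρt≡𝟘))) x≢y

allVecs : ∀ m → List (Pt m)
allVecs 0       = [ [] ]
allVecs (suc m) = cartesianProductWith _∷_ (allFin 3) (allVecs m)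

length-cartesianProductWith : ∀ {a b c} {A : Set a} {B : Set b} {C : Set c} (f : A → B → C) xs ys →
  length (cartesianProductWith f xs ys) ≡ length xs * length ys
length-cartesianProductWith f []       ys = refl
length-cartesianProductWith f (x ∷ xs) ys = begin
  length (map (f x) ys ++ cartesianProductWith f xs ys)  ≡⟨ length-++ (map (f x) ys) ⟩
  length (map (f x) ys) + length (cartesianProductWith f xs ys)
    ≡⟨ cong₂ _+_ (length-map (f x) ys) (length-cartesianProductWith f xs ys) ⟩
  length ys + length xs * length ys                       ∎
  where open ≡-Reasoning

length-allVecs : ∀ m → length (allVecs m) ≡ 3 ^ m
length-allVecs 0       = refl
length-allVecs (suc m) =
  trans (length-cartesianProductWith _∷_ (allFin 3) (allVecs m)) (cong (3 *_) (length-allVecs m))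

allVecs-unique : ∀ m → Unique (allVecs m)
allVecs-unique 0       = [] ∷ []
allVecs-unique (suc m) =
  Unique.cartesianProductWith⁺ _∷_ ∷-injective (Unique.allFin⁺ 3) (allVecs-unique m)

∈-allVecs : ∀ {m} (v : Pt m) → v ∈ allVecs m
∈-allVecs []      = here refl
∈-allVecs (a ∷ v) = ∈-cartesianProductWith⁺ _∷_ (∈-allFin a) (∈-allVecs v)

toA : ∀ {m} → Pt m → Pt (suc m)
toA v = neg (Σ₃ v) ∷ v

InA-toA : ∀ {m} (v : Pt m) → InA (toA v)
InA-toA v = ⊕-inverseˡ (Σ₃ v)

InA⇒≡toA-tail : ∀ {m} {p : Pt (suc m)} → InA p → p ≡ toA (tail p)
InA⇒≡toA-tail {p = a ∷ v} a+Σv≡𝟘 = cong (_∷ v) (inverseˡ-unique a (Σ₃ v) a+Σv≡𝟘)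

exactlyLines-image : ∀ {n k} {A : Set} (f : A → Pt n) (as : List A) →
                     All (ContainsTwo n k ∘ f) as →
                     AllPairs (λ a a′ → ¬ SameLine k (f a) (f a′)) as →
                     (∀ x → ContainsTwo n k x → Any (SameLine k x ∘ f) as) →
                     ExactlyLines n k (length as)
exactlyLines-image f as qualify distinct complete =
  map f as , length-map f as , All.map⁺ qualify , AllPairs.map⁺ distinct
    , λ x two → Any.map⁺ (complete x two)

exactlyLines-base : ExactlyLines 1 zero 1
exactlyLines-base = [ 𝟘 ∷ [] ] , refl , two ∷ [] , [] ∷ [] , complete
  where
  two : ContainsTwo 1 zero (𝟘 ∷ [])
  two = 𝟙 ∷ [] , 𝟚 ∷ [] , (λ ()) , (𝟙 , refl) , (𝟚 , refl) , (λ ()) , (λ ())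
  complete : ∀ x → ContainsTwo 1 zero x → Any (SameLine zero x) [ 𝟘 ∷ [] ]
  complete (a ∷ []) _ = here (SameLine-fromℕ [] a 𝟘)

module _ {m} (k : Fin (suc m)) where

  ContainsTwo-inject₁ : ∀ {p} → ContainsTwo (suc m) k p → ContainsTwo (suc (suc m)) (inject₁ k) (p ∷ʳ 𝟘)
  ContainsTwo-inject₁ {p} =
    TwoInD⇒ContainsTwo ∘ TwoInD-≗ (sym ∘ line-inject₁ k p 𝟘) ∘ TwoInD-∷ʳ𝟘 ∘ ContainsTwo⇒TwoInD

  ContainsTwo-inject₁⁻ : ∀ {p c} → ContainsTwo (suc (suc m)) (inject₁ k) (p ∷ʳ c) →
                         ContainsTwo (suc m) k p × c ≡ 𝟘
  ContainsTwo-inject₁⁻ {p} {c} two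
    with TwoInD-∷ʳ⁻ (line-InA-unique k p) (TwoInD-≗ (line-inject₁ k p c) (ContainsTwo⇒TwoInD two))
  ... | twoₚ , c≡𝟘 = TwoInD⇒ContainsTwo twoₚ , c≡𝟘

  exactlyLines-inject₁ : ∀ {c} → ExactlyLines (suc m) k c → ExactlyLines (suc (suc m)) (inject₁ k) c
  exactlyLines-inject₁ (xs , refl , qualify , distinct , complete) =
    exactlyLines-image (_∷ʳ 𝟘) xs (All.map ContainsTwo-inject₁ qualify)
      (AllPairs.map (λ {p} {p′} ¬same → ¬same ∘ SameLine-inject₁⁻ k p p′) distinct) complete′
    where
    complete′ : ∀ x → ContainsTwo (suc (suc m)) (inject₁ k) x →
                Any (SameLine (inject₁ k) x ∘ (_∷ʳ 𝟘)) xs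
    complete′ x two with initLast x
    ... | p , c , refl with ContainsTwo-inject₁⁻ two
    ... | twoₚ , refl = Any.map (SameLine-inject₁ k 𝟘) (complete p twoₚ)

module _ {m : ℕ} where

  private
    kₘ : Fin (suc (suc m))
    kₘ = fromℕ (suc m)

  ContainsTwo-fromℕ : ∀ p → InA p → ContainsTwo (suc (suc m)) kₘ (p ∷ʳ 𝟘)
  ContainsTwo-fromℕ p =
    TwoInD⇒ContainsTwo {k = kₘ} ∘ TwoInD-≗ (sym ∘ line-fromℕ p 𝟘) ∘ TwoInD-vertical

  ContainsTwo-fromℕ⁻ : ∀ p {c} → ContainsTwo (suc (suc m)) kₘ (p ∷ʳ c) → InA p
  ContainsTwo-fromℕ⁻ p {c} = TwoInD-vertical⁻ ∘ TwoInD-≗ (line-fromℕ p c) ∘ ContainsTwo⇒TwoInD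

  exactlyLines-fromℕ : ExactlyLines (suc (suc m)) kₘ (3 ^ m)
  exactlyLines-fromℕ = subst (ExactlyLines (suc (suc m)) kₘ) (length-allVecs m)
    (exactlyLines-image {k = kₘ} (λ v → toA v ∷ʳ 𝟘) (allVecs m)
      (All.universal (λ v → ContainsTwo-fromℕ (toA v) (InA-toA v)) (allVecs m)) distinct complete)
    where
    distinct : AllPairs (λ v w → ¬ SameLine kₘ (toA v ∷ʳ 𝟘) (toA w ∷ʳ 𝟘)) (allVecs m)
    distinct = AllPairs.map
      (λ {v} {w} v≢w → v≢w ∘ sym ∘ cong tail ∘ SameLine-fromℕ⁻ (toA v) (toA w)) (allVecs-unique m)

    complete : ∀ x → ContainsTwo (suc (suc m)) kₘ x → Any (λ v → SameLine kₘ x (toA v ∷ʳ 𝟘)) (allVecs m)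
    complete x two with initLast x
    ... | p , c , refl = Any.map (λ { refl → onLine }) (∈-allVecs (tail p))
      where
      onLine : SameLine kₘ (p ∷ʳ c) (toA (tail p) ∷ʳ 𝟘)
      onLine = subst (λ q → SameLine kₘ (p ∷ʳ c) (q ∷ʳ 𝟘))
                     (InA⇒≡toA-tail (ContainsTwo-fromℕ⁻ p two)) (SameLine-fromℕ p c 𝟘)

proposition3p4 : (m : ℕ) → let n = suc m in
    ExactlyLines n zero 1
    × ((k : Fin n) → 1 ≤ toℕ k → ExactlyLines n k (3 ^ (toℕ k ∸ 1)))
proposition3p4 0       = exactlyLines-base , λ { zero () }
proposition3p4 (suc m) = exactlyLines-inject₁ zero (proj₁ (proposition3p4 m)) , higher
  where
  higher : (k : Fin (suc (suc m))) → 1 ≤ toℕ k → ExactlyLines (suc (suc m)) k (3 ^ (toℕ k ∸ 1))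
  higher k 1≤k with view k
  ... | ‵fromℕ     rewrite toℕ-fromℕ m   = exactlyLines-fromℕ
  ... | ‵inject₁ j rewrite toℕ-inject₁ j = exactlyLines-inject₁ j (proj₂ (proposition3p4 m) j 1≤k)
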